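{- Let $\alpha,k\in\mathbb{N}$ with $\alpha\geq 2$, and let $n\geq 2\alpha+3$. If $n=\left\lceil\frac{2}{\alpha}k\right\rceil+3$, then there exists a $k$-tuple dominating set of $K(n,2)$ of cardinality $k+2\alpha+1$.
   Context: The Kneser graph $K(n,2)$ has as vertices the $2$-subsets of $[n]=\{1,\dots,n\}$, two vertices adjacent iff disjoint. For a vertex $v$, $N[v]$ is its closed neighbourhood. A set $D$ of vertices is a $k$-tuple dominating set if $|N[v]\cap D|\geq k$ for every vertex $v$. -}

module Defs where

open import Data.Nat using (ℕ; zero; suc; _+_; _*_)
open import Data.Nat.DivMod using (_/_)
open import Data.Fin using (Fin; _<_)
open import Data.Fin.Properties using (_≟_; _<?_)
open import Data.Product using (Σ; _×_; _,_; proj₁)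
open import Data.Sum using (_⊎_)
open import Data.List using (List; length; filter)
open import Data.List.Relation.Unary.Unique.Propositional using (Unique)
open import Relation.Binary.PropositionalEquality using (_≡_)
open import Relation.Nullary using (¬_; Dec; yes; no)
open import Relation.Nullary.Decidable using (_×-dec_; _⊎-dec_; ¬?)

-- Ceiling division ⌈ m / d ⌉ (d ≥ 1); value at d = 0 is irrelevant (set to 0).
ceilDiv : ℕ → ℕ → ℕ
ceilDiv m zero    = 0
ceilDiv m (suc d) = (m + d) / suc d

-- Vertices of the Kneser graph K(n,2): 2-subsets {i,j} of [n], encoded as i < j.
record Vertex (n : ℕ) : Set where
  constructor ⟨_,_,_⟩
  field
    fst  : Fin n
    snd  : Fin n
    fst<snd : fst < snd
open Vertex public

Disjoint : ∀ {n} → Vertex n → Vertex n → Set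
Disjoint u v =
  ¬ (fst u ≡ fst v) × ¬ (fst u ≡ snd v) × ¬ (snd u ≡ fst v) × ¬ (snd u ≡ snd v)

InClosedNbhd : ∀ {n} → Vertex n → Vertex n → Set
InClosedNbhd v w = (fst w ≡ fst v × snd w ≡ snd v) ⊎ Disjoint v w

inClosedNbhd? : ∀ {n} (v w : Vertex n) → Dec (InClosedNbhd v w)
inClosedNbhd? v w =
  ((fst w ≟ fst v) ×-dec (snd w ≟ snd v))
  ⊎-dec (¬? (fst v ≟ fst w) ×-dec ¬? (fst v ≟ snd w)
         ×-dec ¬? (snd v ≟ fst w) ×-dec ¬? (snd v ≟ snd w))

countIn : ∀ {n} → Vertex n → List (Vertex n) → ℕ
countIn v D = length (filter (inClosedNbhd? v) D)

IsKTupleDominating : (n k : ℕ) → List (Vertex n) → Set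
IsKTupleDominating n k D = Unique D × (∀ (v : Vertex n) → k Data.Nat.≤ countIn v D)

{-# OPTIONS --safe #-}

-- Read a list E of 2-subsets of [n] as a graph on [n]. A member w of E misses the closed
-- neighbourhood of v = {a, b} only if w ≠ v meets v, so at most deg a + deg b − 2·[v ∈ E] members
-- of E miss N[v]. Hence if deg a + deg b ≤ 2α + 1 + 2·[ab ∈ E] for all a < b, any k + 2α + 1 edges
-- of E form a k-tuple dominating set. Split [n] as [0, m) ∪ [m, m + α + 2) and take a near
-- α-regular circulant graph on the first part and the complete graph on the second: every pair
-- with a point in the first part has degree sum ≤ α + (α + 1), every other pair is an edge of
-- degree sum 2α + 2. This graph has at least (αm − 1)/2 + (α + 1)(α + 2)/2 edges, which is at
-- least k + 2α + 1 as soon as 2k ≤ α(n − 3), i.e. as soon as n − 3 ≥ ⌈2k/α⌉.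
module Submission where

open import Defs
open import Level using (Level)
open import Data.Nat using (ℕ; zero; suc; _+_; _*_; _∸_; _⊓_; _≤_; _<_; z≤n; s≤s; _≟_; _≤?_; _<?_; ⌊_/2⌋; s≤s⁻¹)
open import Data.Nat.Properties
open import Data.Nat.DivMod using (_/_; _%_; m≡m%n+[m/n]*n; m%n<n)
open import Data.Nat.Tactic.RingSolver using (solve-∀)
open import Data.Fin using (toℕ; fromℕ<)
open import Data.Fin.Properties using (toℕ-fromℕ<; toℕ-injective; toℕ<n) renaming (_≟_ to _≟ᶠ_)
open import Algebra.Properties.CommutativeSemigroup +-commutativeSemigroup using (interchange)
open import Data.List using (List; []; _∷_; _++_; map; length; filter; take)
open import Data.Nat.ListAction using (sum)
open import Data.Nat.ListAction.Properties using (sum-++)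
open import Data.List.Properties using (length-map; length-++; length-take; map-++; filter-accept; filter-reject)
open import Data.List.Relation.Unary.All as All using (All; []; _∷_)
import Data.List.Relation.Unary.All.Properties as All
open import Data.List.Relation.Unary.Any using (here; there)
open import Data.List.Membership.Propositional using (_∈_)
open import Data.List.Membership.Propositional.Properties using (∈-map⁺; ∈-++⁺ˡ; ∈-++⁺ʳ)
open import Data.List.Relation.Unary.Unique.Propositional using (Unique)
import Data.List.Relation.Unary.Unique.Propositional.Properties as Unique
open import Data.List.Relation.Unary.AllPairs using ([]; _∷_)
open import Data.List.Relation.Binary.Disjoint.Propositional using () renaming (Disjoint to DisjointLists)
open import Data.Product using (Σ; _×_; _,_; proj₁; proj₂; map₂)
open import Data.Sum using (_⊎_; inj₁; inj₂)
open import Relation.Binary.PropositionalEquality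
open import Relation.Nullary using (Dec; yes; no; ¬_)
open import Relation.Nullary.Decidable using (¬?)
open import Data.List.Relation.Binary.Sublist.Propositional.Properties using (take-⊆; filter⁺; length-mono-≤)
open import Data.Empty using (⊥-elim)
open import Function using (_∘_)

private variable
  ℓ : Level
  P : Set ℓ

𝟙 : Dec P → ℕ
𝟙 (yes _) = 1
𝟙 (no _)  = 0

𝟙-yes : (P? : Dec P) → P → 𝟙 P? ≡ 1
𝟙-yes (yes _) _ = refl
𝟙-yes (no ¬p) p = ⊥-elim (¬p p)

𝟙-no : (P? : Dec P) → ¬ P → 𝟙 P? ≡ 0
𝟙-no (yes p) ¬p = ⊥-elim (¬p p)
𝟙-no (no _)  _  = refl

interval : ℕ → ℕ → List ℕ
interval o zero    = []
interval o (suc L) = o ∷ interval (suc o) L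

count : ℕ → List ℕ → ℕ
count a xs = sum (map (λ x → 𝟙 (x ≟ a)) xs)

count-++ : ∀ a xs ys → count a (xs ++ ys) ≡ count a xs + count a ys
count-++ a xs ys = trans (cong sum (map-++ _ xs ys)) (sum-++ (map _ xs) _)

interval-++ : ∀ o L M → interval o (L + M) ≡ interval o L ++ interval (o + L) M
interval-++ o zero    M rewrite +-identityʳ o = refl
interval-++ o (suc L) M rewrite +-suc o L = cong (o ∷_) (interval-++ (suc o) L M)

count-interval-++ : ∀ a o L M →
  count a (interval o L) + count a (interval (o + L) M) ≡ count a (interval o (L + M))
count-interval-++ a o L M =
  sym (trans (cong (count a) (interval-++ o L M)) (count-++ a (interval o L) (interval (o + L) M)))

count-interval-≤ : ∀ a o {L M} → L ≤ M → count a (interval o L) ≤ count a (interval o M)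
count-interval-≤ a o {L} {M} L≤M = begin
  count a (interval o L)                                      ≤⟨ m≤m+n _ _ ⟩
  count a (interval o L) + count a (interval (o + L) (M ∸ L)) ≡⟨ count-interval-++ a o L (M ∸ L) ⟩
  count a (interval o (L + (M ∸ L)))                          ≡⟨ cong (count a ∘ interval o) (m+[n∸m]≡n L≤M) ⟩
  count a (interval o M)                                      ∎
  where open ≤-Reasoning

map-+-interval : ∀ c o L → map (_+ c) (interval o L) ≡ interval (o + c) L
map-+-interval c o zero    = refl
map-+-interval c o (suc L) = cong (o + c ∷_) (map-+-interval c (suc o) L)

length-interval : ∀ o L → length (interval o L) ≡ L
length-interval o zero    = refl
length-interval o (suc L) = cong suc (length-interval (suc o) L)

count-interval-< : ∀ {a o} L → a < o → count a (interval o L) ≡ 0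
count-interval-< zero    a<o = refl
count-interval-< {o = o} (suc L) a<o
  rewrite 𝟙-no (o ≟ _) (>⇒≢ a<o) = count-interval-< L (m<n⇒m<1+n a<o)

count-interval-≤1 : ∀ a o L → count a (interval o L) ≤ 1
count-interval-≤1 a o zero    = z≤n
count-interval-≤1 a o (suc L) with o ≟ a
... | yes refl rewrite count-interval-< L (n<1+n a) = ≤-refl
... | no _     = count-interval-≤1 a (suc o) L

interval-bounds : ∀ o L → All (λ i → o ≤ i × i < o + L) (interval o L)
interval-bounds o zero    = []
interval-bounds o (suc L) = (≤-refl , o<o+1+L)
  ∷ All.map (λ {i} (o<i , i<) → <⇒≤ o<i , subst (i <_) (sym (+-suc o L)) i<) (interval-bounds (suc o) L)
  where o<o+1+L = m<m+n o (s≤s z≤n)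

unique-interval : ∀ o L → Unique (interval o L)
unique-interval o zero    = []
unique-interval o (suc L) =
  All.map (λ (o<i , _) → <⇒≢ o<i) (interval-bounds (suc o) L) ∷ unique-interval (suc o) L

∈-interval : ∀ {o i} L → o ≤ i → i < o + L → i ∈ interval o L
∈-interval {o} {i} zero    o≤i i<o+0 = ⊥-elim (<⇒≱ i<o+0 (subst (_≤ i) (sym (+-identityʳ o)) o≤i))
∈-interval {o} {i} (suc L) o≤i i<    with o ≟ i
... | yes refl = here refl
... | no o≢i   = there (∈-interval L (≤∧≢⇒< o≤i o≢i) (subst (i <_) (+-suc o L) i<))

Edge : Set
Edge = ℕ × ℕ

incidence : ℕ → Edge → ℕ
incidence a (i , j) = 𝟙 (i ≟ a) + 𝟙 (j ≟ a)

degree : ℕ → List Edge → ℕ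
degree a E = sum (map (incidence a) E)

degree-++ : ∀ a E F → degree a (E ++ F) ≡ degree a E + degree a F
degree-++ a E F = trans (cong sum (map-++ (incidence a) E F)) (sum-++ (map (incidence a) E) (map (incidence a) F))

span : Edge → ℕ
span (i , j) = j ∸ i

cyclicLength : ℕ → Edge → ℕ
cyclicLength p e = span e ⊓ (p ∸ span e)

Within : ℕ → ℕ → Edge → Set
Within o p (i , j) = o ≤ i × i < j × j < o + p

separated⇒disjoint : ∀ {A : Set} (f : A → ℕ) {t xs ys} →
  All (λ x → f x < t) xs → All (λ y → t ≤ f y) ys → DisjointLists xs ys
separated⇒disjoint f fxs<t t≤fys (x∈xs , x∈ys) = <⇒≱ (All.lookup fxs<t x∈xs) (All.lookup t≤fys x∈ys)

chords : ℕ → List ℕ → List Edge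
chords c = map (λ i → i , i + c)

degree-chords : ∀ a c xs → degree a (chords c xs) ≡ count a xs + count a (map (_+ c) xs)
degree-chords a c []       = refl
degree-chords a c (x ∷ xs) = trans (cong (incidence a (x , x + c) +_) (degree-chords a c xs))
  (interchange (𝟙 (x ≟ a)) (𝟙 (x + c ≟ a)) (count a xs) (count a (map (_+ c) xs)))

length-chords : ∀ c o L → length (chords c (interval o L)) ≡ L
length-chords c o L = trans (length-map _ (interval o L)) (length-interval o L)

span-chords : ∀ c xs → All (λ e → span e ≡ c) (chords c xs)
span-chords c []       = []
span-chords c (x ∷ xs) = m+n∸m≡n x c ∷ span-chords c xs

unique-chords : ∀ c {xs} → Unique xs → Unique (chords c xs)
unique-chords c = Unique.map⁺ (cong proj₁)

within-chords : ∀ {c o p} L → 1 ≤ c → L + c ≤ p → All (Within o p) (chords c (interval o L))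
within-chords {c} {o} {p} L 1≤c L+c≤p = All.map⁺ (All.map within (interval-bounds o L))
  where
  within : ∀ {i} → o ≤ i × i < o + L → Within o p (i , i + c)
  within {i} (o≤i , i<o+L) = o≤i , m<m+n i 1≤c , (begin-strict
      i + c        <⟨ +-monoˡ-< c i<o+L ⟩
      o + L + c    ≡⟨ +-assoc o L c ⟩
      o + (L + c)  ≤⟨ +-monoʳ-≤ o L+c≤p ⟩
      o + p        ∎)
    where open ≤-Reasoning

cyclicLength-chords : ∀ p c xs → All (λ e → cyclicLength p e ≡ c ⊓ (p ∸ c)) (chords c xs)
cyclicLength-chords p c xs = All.map (cong (λ s → s ⊓ (p ∸ s))) (span-chords c xs)

-- The chords of the cycle o, o+1, …, o+p−1 joining vertices at cyclic distance d,
-- each written as (smaller, larger) end.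
cyclicChords : ℕ → ℕ → ℕ → List Edge
cyclicChords o p d = chords d (interval o (p ∸ d)) ++ chords (p ∸ d) (interval o d)

degree-cyclicChords : ∀ a o {p d} → d ≤ p →
  degree a (cyclicChords o p d) ≡ count a (interval o p) + count a (interval o p)
degree-cyclicChords a o {p} {d} d≤p = begin
  degree a (chords d short ++ chords (p ∸ d) wrap)
    ≡⟨ degree-++ a (chords d short) _ ⟩
  degree a (chords d short) + degree a (chords (p ∸ d) wrap)
    ≡⟨ cong₂ _+_ (degree-chords a d short) (degree-chords a (p ∸ d) wrap) ⟩
  (c short + c (map (_+ d) short)) + (c wrap + c (map (_+ (p ∸ d)) wrap))
    ≡⟨ cong₂ (λ xs ys → (c short + c xs) + (c wrap + c ys)) (map-+-interval d o (p ∸ d)) (map-+-interval (p ∸ d) o d) ⟩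
  (c short + c (interval (o + d) (p ∸ d))) + (c wrap + c (interval (o + (p ∸ d)) d))
    ≡⟨ swap-outer (c short) _ (c wrap) _ ⟩
  (c short + c (interval (o + (p ∸ d)) d)) + (c wrap + c (interval (o + d) (p ∸ d)))
    ≡⟨ cong₂ _+_ (count-interval-++ a o (p ∸ d) d) (count-interval-++ a o d (p ∸ d)) ⟩
  c (interval o ((p ∸ d) + d)) + c (interval o (d + (p ∸ d)))
    ≡⟨ cong₂ (λ L M → c (interval o L) + c (interval o M)) (m∸n+n≡m d≤p) (m+[n∸m]≡n d≤p) ⟩
  c (interval o p) + c (interval o p) ∎
  where
  open ≡-Reasoning
  c = count a
  short = interval o (p ∸ d)
  wrap = interval o d
  swap-outer : ∀ w x y z → (w + x) + (y + z) ≡ (w + z) + (y + x)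
  swap-outer = solve-∀

length-cyclicChords : ∀ o {p d} → d ≤ p → length (cyclicChords o p d) ≡ p
length-cyclicChords o {p} {d} d≤p = begin
  length (chords d (interval o (p ∸ d)) ++ chords (p ∸ d) (interval o d))
    ≡⟨ length-++ (chords d (interval o (p ∸ d))) ⟩
  length (chords d (interval o (p ∸ d))) + length (chords (p ∸ d) (interval o d))
    ≡⟨ cong₂ _+_ (length-chords d o (p ∸ d)) (length-chords (p ∸ d) o d) ⟩
  (p ∸ d) + d
    ≡⟨ m∸n+n≡m d≤p ⟩
  p ∎
  where open ≡-Reasoning

within-cyclicChords : ∀ o {p d} → 1 ≤ d → d < p → All (Within o p) (cyclicChords o p d)
within-cyclicChords o {p} {d} 1≤d d<p = All.++⁺
  (within-chords (p ∸ d) 1≤d (≤-reflexive (m∸n+n≡m (<⇒≤ d<p))))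
  (within-chords d (m<n⇒0<n∸m d<p) (≤-reflexive (m+[n∸m]≡n (<⇒≤ d<p))))

cyclicLength-cyclicChords : ∀ o {p d} → d + d ≤ p → All (λ e → cyclicLength p e ≡ d) (cyclicChords o p d)
cyclicLength-cyclicChords o {p} {d} d+d≤p = All.++⁺
  (All.map (λ eq → trans eq (m≤n⇒m⊓n≡m d≤p∸d)) (cyclicLength-chords p d (interval o (p ∸ d))))
  (All.map (λ eq → trans eq p∸d⊓d≡d) (cyclicLength-chords p (p ∸ d) (interval o d)))
  where
  d≤p∸d : d ≤ p ∸ d
  d≤p∸d = m+n≤o⇒m≤o∸n d d+d≤p
  p∸d⊓d≡d : (p ∸ d) ⊓ (p ∸ (p ∸ d)) ≡ d
  p∸d⊓d≡d rewrite m∸[m∸n]≡n (m+n≤o⇒m≤o d d+d≤p) = m≥n⇒m⊓n≡n d≤p∸d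

unique-cyclicChords : ∀ o {p d} → d + d < p → Unique (cyclicChords o p d)
unique-cyclicChords o {p} {d} d+d<p = Unique.++⁺
  (unique-chords d (unique-interval o (p ∸ d)))
  (unique-chords (p ∸ d) (unique-interval o d))
  (separated⇒disjoint span {suc d}
    (All.map (λ eq → ≤-reflexive (cong suc eq)) (span-chords d (interval o (p ∸ d))))
    (All.map (λ eq → subst (suc d ≤_) (sym eq) (m+n≤o⇒m≤o∸n (suc d) d+d<p)) (span-chords (p ∸ d) (interval o d))))

r+r≤[1+r]+[1+r] : ∀ r → r + r ≤ suc r + suc r
r+r≤[1+r]+[1+r] r = +-mono-≤ (n≤1+n r) (n≤1+n r)

circulant : ℕ → ℕ → ℕ → List Edge
circulant o p zero    = []
circulant o p (suc r) = circulant o p r ++ cyclicChords o p (suc r)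

degree-circulant : ∀ a o {p} r → r ≤ p → degree a (circulant o p r) ≡ (r + r) * count a (interval o p)
degree-circulant a o     zero    _   = refl
degree-circulant a o {p} (suc r) r<p = begin
  degree a (circulant o p r ++ cyclicChords o p (suc r))
    ≡⟨ degree-++ a (circulant o p r) _ ⟩
  degree a (circulant o p r) + degree a (cyclicChords o p (suc r))
    ≡⟨ cong₂ _+_ (degree-circulant a o r (<⇒≤ r<p)) (degree-cyclicChords a o r<p) ⟩
  (r + r) * c + (c + c)
    ≡⟨ add-two-copies r c ⟩
  (suc r + suc r) * c ∎
  where
  open ≡-Reasoning
  c = count a (interval o p)
  add-two-copies : ∀ r c → (r + r) * c + (c + c) ≡ (suc r + suc r) * c
  add-two-copies = solve-∀

length-circulant : ∀ o {p} r → r ≤ p → length (circulant o p r) ≡ r * p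
length-circulant o     zero    _   = refl
length-circulant o {p} (suc r) r<p = begin
  length (circulant o p r ++ cyclicChords o p (suc r))
    ≡⟨ length-++ (circulant o p r) ⟩
  length (circulant o p r) + length (cyclicChords o p (suc r))
    ≡⟨ cong₂ _+_ (length-circulant o r (<⇒≤ r<p)) (length-cyclicChords o r<p) ⟩
  r * p + p
    ≡⟨ +-comm (r * p) p ⟩
  suc r * p ∎
  where open ≡-Reasoning

within-circulant : ∀ o {p} r → r < p → All (Within o p) (circulant o p r)
within-circulant o zero    _   = []
within-circulant o (suc r) r<p =
  All.++⁺ (within-circulant o r (<-trans (n<1+n r) r<p)) (within-cyclicChords o (s≤s z≤n) r<p)

cyclicLength-circulant : ∀ o {p} r → r + r ≤ p → All (λ e → cyclicLength p e ≤ r) (circulant o p r)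
cyclicLength-circulant o zero    _     = []
cyclicLength-circulant o (suc r) [1+r]+[1+r]≤p = All.++⁺
  (All.map m≤n⇒m≤1+n (cyclicLength-circulant o r (≤-trans (r+r≤[1+r]+[1+r] r) [1+r]+[1+r]≤p)))
  (All.map ≤-reflexive (cyclicLength-cyclicChords o {d = suc r} [1+r]+[1+r]≤p))

unique-circulant : ∀ o {p} r → r + r < p → Unique (circulant o p r)
unique-circulant o     zero    _     = []
unique-circulant o {p} (suc r) [1+r]+[1+r]<p = Unique.++⁺
  (unique-circulant o r (≤-<-trans (r+r≤[1+r]+[1+r] r) [1+r]+[1+r]<p))
  (unique-cyclicChords o {d = suc r} [1+r]+[1+r]<p)
  (separated⇒disjoint (cyclicLength p) {suc r}
    (All.map s≤s (cyclicLength-circulant o r (≤-trans (r+r≤[1+r]+[1+r] r) (<⇒≤ [1+r]+[1+r]<p))))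
    (All.map (λ eq → ≤-reflexive (sym eq)) (cyclicLength-cyclicChords o {d = suc r} (<⇒≤ [1+r]+[1+r]<p))))

chord-fits : ∀ {o p a t} → o ≤ a → a + t < o + p → t < p
chord-fits {o} {p} {a} {t} o≤a a+t<o+p = +-cancelˡ-< o t p (≤-trans (s≤s (+-monoˡ-≤ t o≤a)) a+t<o+p)

chord-start∈ : ∀ {o p a t} → o ≤ a → a + t < o + p → a ∈ interval o (p ∸ t)
chord-start∈ {o} {p} {a} {t} o≤a a+t<o+p = ∈-interval (p ∸ t) o≤a
  (subst (a <_) (+-∸-assoc o (<⇒≤ (chord-fits o≤a a+t<o+p))) (m+n≤o⇒m≤o∸n (suc a) a+t<o+p))

∈-cyclicChords : ∀ {o p a t} → o ≤ a → a + t < o + p → (a , a + t) ∈ cyclicChords o p t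
∈-cyclicChords o≤a a+t<o+p = ∈-++⁺ˡ (∈-map⁺ _ (chord-start∈ o≤a a+t<o+p))

∈-cyclicChords-wrap : ∀ {o p a t} → o ≤ a → a + t < o + p → (a , a + t) ∈ cyclicChords o p (p ∸ t)
∈-cyclicChords-wrap {o} {p} {a} {t} o≤a a+t<o+p = ∈-++⁺ʳ (chords (p ∸ t) (interval o (p ∸ (p ∸ t))))
  (subst (λ s → (a , a + s) ∈ chords (p ∸ (p ∸ t)) (interval o (p ∸ t)))
         (m∸[m∸n]≡n (<⇒≤ (chord-fits o≤a a+t<o+p)))
         (∈-map⁺ _ (chord-start∈ o≤a a+t<o+p)))

cyclicChords⊆circulant : ∀ {o p d e} r → 1 ≤ d → d ≤ r → e ∈ cyclicChords o p d → e ∈ circulant o p r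
cyclicChords⊆circulant zero 1≤d d≤0 _ = ⊥-elim (<⇒≱ 1≤d d≤0)
cyclicChords⊆circulant {o} {p} {d} (suc r) 1≤d d≤1+r e∈ with d ≟ suc r
... | yes refl = ∈-++⁺ʳ (circulant o p r) e∈
... | no d≢1+r = ∈-++⁺ˡ (cyclicChords⊆circulant r 1≤d (s≤s⁻¹ (≤∧≢⇒< d≤1+r d≢1+r)) e∈)

∈-circulant : ∀ {o p a t} r → o ≤ a → 1 ≤ t → a + t < o + p → t ≤ r ⊎ p ≤ t + r →
  (a , a + t) ∈ circulant o p r
∈-circulant r o≤a 1≤t a+t<o+p (inj₁ t≤r) = cyclicChords⊆circulant r 1≤t t≤r (∈-cyclicChords o≤a a+t<o+p)
∈-circulant {p = p} {t = t} r o≤a 1≤t a+t<o+p (inj₂ p≤t+r) =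
  cyclicChords⊆circulant r (m<n⇒0<n∸m (chord-fits o≤a a+t<o+p)) (m≤n+o⇒m∸n≤o p t p≤t+r) (∈-cyclicChords-wrap o≤a a+t<o+p)

matching : ℕ → ℕ → List Edge
matching o h = chords h (interval o h)

degree-matching : ∀ a o h {p} → h + h ≤ p → degree a (matching o h) ≤ count a (interval o p)
degree-matching a o h {p} h+h≤p = begin
  degree a (matching o h)                                      ≡⟨ degree-chords a h (interval o h) ⟩
  count a (interval o h) + count a (map (_+ h) (interval o h)) ≡⟨ cong (λ xs → count a (interval o h) + count a xs) (map-+-interval h o h) ⟩
  count a (interval o h) + count a (interval (o + h) h)        ≡⟨ count-interval-++ a o h h ⟩
  count a (interval o (h + h))                                 ≤⟨ count-interval-≤ a o h+h≤p ⟩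
  count a (interval o p)                                       ∎
  where open ≤-Reasoning

cyclicLength-matching : ∀ o h {p} → h + h ≤ p → All (λ e → cyclicLength p e ≡ h) (matching o h)
cyclicLength-matching o h h+h≤p =
  All.map (λ eq → trans eq (m≤n⇒m⊓n≡m (m+n≤o⇒m≤o∸n h h+h≤p))) (cyclicLength-chords _ h (interval o h))

∈-matching : ∀ {o h a} → o ≤ a → a + h < o + h + h → (a , a + h) ∈ matching o h
∈-matching {o} {h} {a} o≤a a+h<o+h+h = ∈-map⁺ _ (∈-interval h o≤a (+-cancelʳ-< h a (o + h) a+h<o+h+h))

complete-by-span : ∀ {o p} {E : List Edge} →
  (∀ {a t} → o ≤ a → 1 ≤ t → a + t < o + p → (a , a + t) ∈ E) →
  ∀ {a b} → o ≤ a → a < b → b < o + p → (a , b) ∈ E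
complete-by-span {o} {p} {E} span-complete {a} {b} o≤a a<b b<o+p =
  subst (λ b → (a , b) ∈ E) (sym b≡a+t) (span-complete o≤a (m<n⇒0<n∸m a<b) (subst (_< o + p) b≡a+t b<o+p))
  where b≡a+t = sym (m+[n∸m]≡n (<⇒≤ a<b))

⌊n/2⌋+⌊n/2⌋≤n : ∀ n → ⌊ n /2⌋ + ⌊ n /2⌋ ≤ n
⌊n/2⌋+⌊n/2⌋≤n zero          = z≤n
⌊n/2⌋+⌊n/2⌋≤n (suc zero)    = z≤n
⌊n/2⌋+⌊n/2⌋≤n (suc (suc n)) =
  s≤s (subst (_≤ suc n) (sym (+-suc ⌊ n /2⌋ ⌊ n /2⌋)) (s≤s (⌊n/2⌋+⌊n/2⌋≤n n)))

n≤1+⌊n/2⌋+⌊n/2⌋ : ∀ n → n ≤ suc (⌊ n /2⌋ + ⌊ n /2⌋)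
n≤1+⌊n/2⌋+⌊n/2⌋ zero          = z≤n
n≤1+⌊n/2⌋+⌊n/2⌋ (suc zero)    = s≤s z≤n
n≤1+⌊n/2⌋+⌊n/2⌋ (suc (suc n)) =
  s≤s (subst (suc n ≤_) (cong suc (sym (+-suc ⌊ n /2⌋ ⌊ n /2⌋))) (s≤s (n≤1+⌊n/2⌋+⌊n/2⌋ n)))

data Parity : ℕ → Set where
  even : ∀ r → Parity (r + r)
  odd  : ∀ r → Parity (suc (r + r))

parity : ∀ n → Parity n
parity zero    = even 0
parity (suc n) with parity n
... | even r = odd r
... | odd r  = subst Parity (cong suc (+-suc r r)) (even (suc r))

-- A d-regular graph on [o, o+m), except for one vertex of degree d − 1 when d and m are both odd.
nearRegular : ∀ {d} → Parity d → ℕ → ℕ → List Edge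
nearRegular (even r) o m = circulant o m r
nearRegular (odd r)  o m = circulant o m r ++ matching o ⌊ m /2⌋

1+r+r<m⇒r<⌊m/2⌋ : ∀ {r m} → suc (r + r) < m → r < ⌊ m /2⌋
1+r+r<m⇒r<⌊m/2⌋ {r} {m} 1+r+r<m = begin-strict
  r                        <⟨ n<1+n r ⟩
  suc r                    ≡⟨ n≡⌊n+n/2⌋ (suc r) ⟩
  ⌊ suc r + suc r /2⌋      ≤⟨ ⌊n/2⌋-mono (subst (_≤ m) (cong suc (sym (+-suc r r))) 1+r+r<m) ⟩
  ⌊ m /2⌋                  ∎
  where open ≤-Reasoning

within-nearRegular : ∀ {d} (π : Parity d) o {m} → d < m → All (Within o m) (nearRegular π o m)
within-nearRegular (even r) o d<m = within-circulant o r (≤-<-trans (m≤m+n r r) d<m)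
within-nearRegular (odd r)  o {m} d<m = All.++⁺
  (within-circulant o r (≤-<-trans (m≤m+n r r) (<-trans (n<1+n _) d<m)))
  (within-chords ⌊ m /2⌋ (≤-<-trans z≤n (1+r+r<m⇒r<⌊m/2⌋ {r} d<m)) (⌊n/2⌋+⌊n/2⌋≤n m))

unique-nearRegular : ∀ {d} (π : Parity d) o {m} → d < m → Unique (nearRegular π o m)
unique-nearRegular (even r) o d<m = unique-circulant o r d<m
unique-nearRegular (odd r)  o {m} d<m = Unique.++⁺
  (unique-circulant o r (<-trans (n<1+n _) d<m))
  (unique-chords ⌊ m /2⌋ (unique-interval o ⌊ m /2⌋))
  (separated⇒disjoint (cyclicLength m) {suc r}
    (All.map s≤s (cyclicLength-circulant o r (<⇒≤ (<-trans (n<1+n _) d<m))))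
    (All.map (λ eq → subst (suc r ≤_) (sym eq) (1+r+r<m⇒r<⌊m/2⌋ {r} d<m)) (cyclicLength-matching o ⌊ m /2⌋ (⌊n/2⌋+⌊n/2⌋≤n m))))

degree-nearRegular : ∀ a {d} (π : Parity d) o {m} → d < m →
  degree a (nearRegular π o m) ≤ d * count a (interval o m)
degree-nearRegular a (even r) o d<m = ≤-reflexive (degree-circulant a o r (≤-trans (m≤m+n r r) (<⇒≤ d<m)))
degree-nearRegular a (odd r)  o {m} d<m = begin
  degree a (circulant o m r ++ matching o ⌊ m /2⌋)
    ≡⟨ degree-++ a (circulant o m r) _ ⟩
  degree a (circulant o m r) + degree a (matching o ⌊ m /2⌋)
    ≤⟨ +-mono-≤ (≤-reflexive (degree-circulant a o r r≤m)) (degree-matching a o ⌊ m /2⌋ (⌊n/2⌋+⌊n/2⌋≤n m)) ⟩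
  (r + r) * count a (interval o m) + count a (interval o m)
    ≡⟨ +-comm ((r + r) * count a (interval o m)) _ ⟩
  suc (r + r) * count a (interval o m) ∎
  where
  open ≤-Reasoning
  r≤m = ≤-trans (m≤m+n r r) (≤-trans (n≤1+n _) (<⇒≤ d<m))

length-nearRegular : ∀ {d} (π : Parity d) o {m} → d < m → d * m ≤ suc (2 * length (nearRegular π o m))
length-nearRegular (even r) o {m} d<m = begin
  (r + r) * m                        ≡⟨ double r m ⟩
  2 * (r * m)                        ≡⟨ cong (2 *_) (sym (length-circulant o r (≤-trans (m≤m+n r r) (<⇒≤ d<m)))) ⟩
  2 * length (circulant o m r)       <⟨ n<1+n _ ⟩
  suc (2 * length (circulant o m r)) ∎
  where
  open ≤-Reasoning
  double : ∀ r m → (r + r) * m ≡ 2 * (r * m)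
  double = solve-∀
length-nearRegular (odd r) o {m} d<m = begin
  suc (r + r) * m                                ≡⟨ +-comm m _ ⟩
  (r + r) * m + m                                ≤⟨ +-monoʳ-≤ _ (n≤1+⌊n/2⌋+⌊n/2⌋ m) ⟩
  (r + r) * m + suc (⌊ m /2⌋ + ⌊ m /2⌋)          ≡⟨ regroup r m ⌊ m /2⌋ ⟩
  suc (2 * (r * m + ⌊ m /2⌋))                    ≡⟨ cong (λ L → suc (2 * (L + ⌊ m /2⌋))) (sym (length-circulant o r r≤m)) ⟩
  suc (2 * (length (circulant o m r) + ⌊ m /2⌋)) ≡⟨ cong (λ L → suc (2 * (length (circulant o m r) + L))) (sym (length-chords ⌊ m /2⌋ o ⌊ m /2⌋)) ⟩
  suc (2 * (length (circulant o m r) + length (matching o ⌊ m /2⌋))) ≡⟨ cong (suc ∘ (2 *_)) (sym (length-++ (circulant o m r))) ⟩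
  suc (2 * length (circulant o m r ++ matching o ⌊ m /2⌋)) ∎
  where
  open ≤-Reasoning
  r≤m = ≤-trans (m≤m+n r r) (≤-trans (n≤1+n _) (<⇒≤ d<m))
  regroup : ∀ r m h → (r + r) * m + suc (h + h) ≡ suc (2 * (r * m + h))
  regroup = solve-∀

length-nearRegular-suc : ∀ {d} (π : Parity d) o → 2 * length (nearRegular π o (suc d)) ≡ d * suc d
length-nearRegular-suc (even r) o = begin
  2 * length (circulant o (suc (r + r)) r) ≡⟨ cong (2 *_) (length-circulant o r (≤-trans (m≤m+n r r) (n≤1+n _))) ⟩
  2 * (r * suc (r + r))                    ≡⟨ double r ⟩
  (r + r) * suc (r + r)                    ∎
  where
  open ≡-Reasoning
  double : ∀ r → 2 * (r * suc (r + r)) ≡ (r + r) * suc (r + r)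
  double = solve-∀
length-nearRegular-suc (odd r) o = begin
  2 * length (circulant o p r ++ matching o ⌊ p /2⌋)
    ≡⟨ cong (2 *_) (length-++ (circulant o p r)) ⟩
  2 * (length (circulant o p r) + length (matching o ⌊ p /2⌋))
    ≡⟨ cong₂ (λ L M → 2 * (L + M)) (length-circulant o r (≤-trans (m≤m+n r r) (≤-trans (n≤1+n _) (n≤1+n _))))
                                    (length-chords ⌊ p /2⌋ o ⌊ p /2⌋) ⟩
  2 * (r * p + ⌊ p /2⌋)
    ≡⟨ cong (λ h → 2 * (r * p + h)) (cong suc (sym (n≡⌊n+n/2⌋ r))) ⟩
  2 * (r * p + suc r)
    ≡⟨ regroup r ⟩
  suc (r + r) * p ∎
  where
  open ≡-Reasoning
  p = suc (suc (r + r))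
  regroup : ∀ r → 2 * (r * suc (suc (r + r)) + suc r) ≡ suc (r + r) * suc (suc (r + r))
  regroup = solve-∀

complete-nearRegular : ∀ {d} (π : Parity d) o {a b} → o ≤ a → a < b → b < o + suc d →
  (a , b) ∈ nearRegular π o (suc d)
complete-nearRegular (even r) o = complete-by-span span-complete
  where
  span-complete : ∀ {a t} → o ≤ a → 1 ≤ t → a + t < o + suc (r + r) →
    (a , a + t) ∈ circulant o (suc (r + r)) r
  span-complete {t = t} o≤a 1≤t fits with t ≤? r
  ... | yes t≤r = ∈-circulant r o≤a 1≤t fits (inj₁ t≤r)
  ... | no  t≰r = ∈-circulant r o≤a 1≤t fits (inj₂ (+-monoˡ-≤ r (≰⇒> t≰r)))
complete-nearRegular (odd r) o = complete-by-span span-complete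
  where
  p = suc (suc (r + r))
  span-complete : ∀ {a t} → o ≤ a → 1 ≤ t → a + t < o + p →
    (a , a + t) ∈ circulant o p r ++ matching o ⌊ p /2⌋
  span-complete {a} {t} o≤a 1≤t fits with t ≤? r | t ≟ suc r
  ... | yes t≤r | _ = ∈-++⁺ˡ (∈-circulant r o≤a 1≤t fits (inj₁ t≤r))
  ... | no  _   | yes refl = ∈-++⁺ʳ (circulant o p r)
    (subst (λ h → (a , a + suc r) ∈ matching o h) (cong suc (n≡⌊n+n/2⌋ r))
      (∈-matching o≤a (subst (a + suc r <_) (o+p≡o+1+r+1+r o r) fits)))
    where
    o+p≡o+1+r+1+r : ∀ o r → o + suc (suc (r + r)) ≡ o + suc r + suc r
    o+p≡o+1+r+1+r = solve-∀
  ... | no  t≰r | no t≢1+r = ∈-++⁺ˡ (∈-circulant r o≤a 1≤t fits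
    (inj₂ (+-monoˡ-≤ r (≤∧≢⇒< (≰⇒> t≰r) (t≢1+r ∘ sym)))))

KTupleDominatingSet : (n k s : ℕ) → Set
KTupleDominatingSet n k s = Σ (List (Vertex n)) (λ D → IsKTupleDominating n k D × length D ≡ s)

IsEdge : ℕ → Edge → Set
IsEdge n (i , j) = i < j × j < n

within⇒isEdge : ∀ {o p n} e → o + p ≤ n → Within o p e → IsEdge n e
within⇒isEdge (i , j) o+p≤n (_ , i<j , j<o+p) = i<j , ≤-trans j<o+p o+p≤n

DegreeSumBound : ℕ → ℕ → List Edge → Set
DegreeSumBound n β E = ∀ {a b} → IsEdge n (a , b) →
  ((a , b) ∈ E × degree a E + degree b E ≤ 2 + β) ⊎ degree a E + degree b E ≤ β

incidence-fst : ∀ {a} e → proj₁ e ≡ a → 1 ≤ incidence a e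
incidence-fst {a} (i , j) i≡a rewrite 𝟙-yes (i ≟ a) i≡a = s≤s z≤n

incidence-snd : ∀ {a} e → proj₂ e ≡ a → 1 ≤ incidence a e
incidence-snd {a} (i , j) j≡a rewrite 𝟙-yes (j ≟ a) j≡a = m≤n+m 1 (𝟙 (i ≟ a))

module _ {n : ℕ} where

  pair : Vertex n → Edge
  pair v = toℕ (fst v) , toℕ (snd v)

  pair-isEdge : ∀ v → IsEdge n (pair v)
  pair-isEdge v = fst<snd v , toℕ<n (snd v)

  vertex : ∀ e → IsEdge n e → Vertex n
  vertex (i , j) (i<j , j<n) = ⟨ fromℕ< (<-trans i<j j<n) , fromℕ< j<n ,
    subst₂ _<_ (sym (toℕ-fromℕ< (<-trans i<j j<n))) (sym (toℕ-fromℕ< j<n)) i<j ⟩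

  vertices : ∀ {E} → All (IsEdge n) E → List (Vertex n)
  vertices []                  = []
  vertices {e ∷ _} (e∈n ∷ E∈n) = vertex e e∈n ∷ vertices E∈n

  map-pair-vertices : ∀ {E} (E∈n : All (IsEdge n) E) → map pair (vertices E∈n) ≡ E
  map-pair-vertices [] = refl
  map-pair-vertices {(i , j) ∷ _} ((i<j , j<n) ∷ E∈n) =
    cong₂ _∷_ (cong₂ _,_ (toℕ-fromℕ< (<-trans i<j j<n)) (toℕ-fromℕ< j<n)) (map-pair-vertices E∈n)

  degreeSum : Vertex n → List Edge → ℕ
  degreeSum v E = degree (toℕ (fst v)) E + degree (toℕ (snd v)) E

  incidenceSum : Vertex n → Edge → ℕ
  incidenceSum v e = incidence (toℕ (fst v)) e + incidence (toℕ (snd v)) e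

  nonNeighbour-meets : ∀ v w → ¬ InClosedNbhd v w → 1 ≤ incidenceSum v (pair w)
  nonNeighbour-meets v w w∉N[v] with fst v ≟ᶠ fst w | fst v ≟ᶠ snd w | snd v ≟ᶠ fst w | snd v ≟ᶠ snd w
  ... | yes eq | _      | _      | _      = ≤-trans (incidence-fst (pair w) (cong toℕ (sym eq))) (m≤m+n _ _)
  ... | no _   | yes eq | _      | _      = ≤-trans (incidence-snd (pair w) (cong toℕ (sym eq))) (m≤m+n _ _)
  ... | no _   | no _   | yes eq | _      = ≤-trans (incidence-fst (pair w) (cong toℕ (sym eq))) (m≤n+m _ (incidence (toℕ (fst v)) (pair w)))
  ... | no _   | no _   | no _   | yes eq = ≤-trans (incidence-snd (pair w) (cong toℕ (sym eq))) (m≤n+m _ (incidence (toℕ (fst v)) (pair w)))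
  ... | no ≢₁  | no ≢₂  | no ≢₃  | no ≢₄  = ⊥-elim (w∉N[v] (inj₂ (≢₁ , ≢₂ , ≢₃ , ≢₄)))

  self-incidence : ∀ v → 2 ≤ incidenceSum v (pair v)
  self-incidence v = +-mono-≤ (incidence-fst (pair v) refl) (incidence-snd (pair v) refl)

  outside : Vertex n → List (Vertex n) → ℕ
  outside v L = length (filter (¬? ∘ inClosedNbhd? v) L)

  countIn+outside : ∀ v L → countIn v L + outside v L ≡ length L
  countIn+outside v []      = refl
  countIn+outside v (w ∷ L) with inClosedNbhd? v w
  ... | yes w∈N[v] rewrite filter-accept (inClosedNbhd? v) {w} {L} w∈N[v]
                         | filter-reject (¬? ∘ inClosedNbhd? v) {w} {L} (λ w∉N[v] → w∉N[v] w∈N[v]) =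
    cong suc (countIn+outside v L)
  ... | no w∉N[v]  rewrite filter-reject (inClosedNbhd? v) {w} {L} w∉N[v]
                         | filter-accept (¬? ∘ inClosedNbhd? v) {w} {L} w∉N[v] =
    trans (+-suc (countIn v L) (outside v L)) (cong suc (countIn+outside v L))

  outside-take : ∀ v T L → outside v (take T L) ≤ outside v L
  outside-take v T L = length-mono-≤ (filter⁺ (¬? ∘ inClosedNbhd? v) (¬? ∘ inClosedNbhd? v) (λ { refl p → p }) (take-⊆ T L))

  outside-∷-neighbour : ∀ v w L → InClosedNbhd v w → outside v (w ∷ L) ≡ outside v L
  outside-∷-neighbour v w L w∈N[v] =
    cong length (filter-reject (¬? ∘ inClosedNbhd? v) {xs = L} (λ w∉N[v] → w∉N[v] w∈N[v]))

  outside-∷-nonNeighbour : ∀ v w L → ¬ InClosedNbhd v w → outside v (w ∷ L) ≡ suc (outside v L)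
  outside-∷-nonNeighbour v w L w∉N[v] = cong length (filter-accept (¬? ∘ inClosedNbhd? v) {xs = L} w∉N[v])

  degreeSum-∷ : ∀ v e E → degreeSum v (e ∷ E) ≡ incidenceSum v e + degreeSum v E
  degreeSum-∷ v e E = interchange (incidence (toℕ (fst v)) e) (degree (toℕ (fst v)) E)
                                  (incidence (toℕ (snd v)) e) (degree (toℕ (snd v)) E)

  outside≤degreeSum : ∀ v L → outside v L ≤ degreeSum v (map pair L)
  outside≤degreeSum v []      = z≤n
  outside≤degreeSum v (w ∷ L) with inClosedNbhd? v w
  ... | yes w∈N[v] = begin
    outside v (w ∷ L)                ≡⟨ outside-∷-neighbour v w L w∈N[v] ⟩
    outside v L                      ≤⟨ outside≤degreeSum v L ⟩
    degreeSum v (map pair L)         ≤⟨ m≤n+m _ (incidenceSum v (pair w)) ⟩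
    incidenceSum v (pair w) + degreeSum v (map pair L) ≡⟨ degreeSum-∷ v (pair w) (map pair L) ⟨
    degreeSum v (map pair (w ∷ L))   ∎
    where open ≤-Reasoning
  ... | no w∉N[v] = begin
    outside v (w ∷ L)                ≡⟨ outside-∷-nonNeighbour v w L w∉N[v] ⟩
    1 + outside v L                  ≤⟨ +-mono-≤ (nonNeighbour-meets v w w∉N[v]) (outside≤degreeSum v L) ⟩
    incidenceSum v (pair w) + degreeSum v (map pair L) ≡⟨ degreeSum-∷ v (pair w) (map pair L) ⟨
    degreeSum v (map pair (w ∷ L))   ∎
    where open ≤-Reasoning

  outside-∈ : ∀ v L → pair v ∈ map pair L → 2 + outside v L ≤ degreeSum v (map pair L)
  outside-∈ v (w ∷ L) v∈L with inClosedNbhd? v w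
  outside-∈ v (w ∷ L) (here v≡w) | yes w∈N[v] = begin
    2 + outside v (w ∷ L)            ≡⟨ cong (2 +_) (outside-∷-neighbour v w L w∈N[v]) ⟩
    2 + outside v L                  ≤⟨ +-mono-≤ (subst (λ e → 2 ≤ incidenceSum v e) v≡w (self-incidence v))
                                                 (outside≤degreeSum v L) ⟩
    incidenceSum v (pair w) + degreeSum v (map pair L) ≡⟨ degreeSum-∷ v (pair w) (map pair L) ⟨
    degreeSum v (map pair (w ∷ L))   ∎
    where open ≤-Reasoning
  outside-∈ v (w ∷ L) (here v≡w) | no w∉N[v] =
    ⊥-elim (w∉N[v] (inj₁ (toℕ-injective (cong proj₁ (sym v≡w)) , toℕ-injective (cong proj₂ (sym v≡w)))))
  outside-∈ v (w ∷ L) (there v∈L) | yes w∈N[v] = begin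
    2 + outside v (w ∷ L)            ≡⟨ cong (2 +_) (outside-∷-neighbour v w L w∈N[v]) ⟩
    2 + outside v L                  ≤⟨ outside-∈ v L v∈L ⟩
    degreeSum v (map pair L)         ≤⟨ m≤n+m _ (incidenceSum v (pair w)) ⟩
    incidenceSum v (pair w) + degreeSum v (map pair L) ≡⟨ degreeSum-∷ v (pair w) (map pair L) ⟨
    degreeSum v (map pair (w ∷ L))   ∎
    where open ≤-Reasoning
  outside-∈ v (w ∷ L) (there v∈L) | no w∉N[v] = begin
    2 + outside v (w ∷ L)            ≡⟨ cong (2 +_) (outside-∷-nonNeighbour v w L w∉N[v]) ⟩
    1 + (2 + outside v L)            ≤⟨ +-mono-≤ (nonNeighbour-meets v w w∉N[v]) (outside-∈ v L v∈L) ⟩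
    incidenceSum v (pair w) + degreeSum v (map pair L) ≡⟨ degreeSum-∷ v (pair w) (map pair L) ⟨
    degreeSum v (map pair (w ∷ L))   ∎
    where open ≤-Reasoning

  kTupleDominating-fromEdges : ∀ k β {E} → All (IsEdge n) E → Unique E → DegreeSumBound n β E →
    k + β ≤ length E → KTupleDominatingSet n k (k + β)
  kTupleDominating-fromEdges k β {E} E∈n E! bound k+β≤|E| = D , (D! , dominates) , |D|≡k+β
    where
    L = vertices E∈n
    D = take (k + β) L

    D! : Unique D
    D! = Unique.take⁺ (k + β) (Unique.map⁻ (subst Unique (sym (map-pair-vertices E∈n)) E!))

    |D|≡k+β : length D ≡ k + β
    |D|≡k+β = trans (length-take (k + β) L) (m≤n⇒m⊓n≡m (subst (k + β ≤_) |E|≡|L| k+β≤|E|))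
      where |E|≡|L| = trans (cong length (sym (map-pair-vertices E∈n))) (length-map pair L)

    outside≤β : ∀ v → outside v L ≤ β
    outside≤β v with subst (DegreeSumBound n β) (sym (map-pair-vertices E∈n)) bound (pair-isEdge v)
    ... | inj₁ (v∈L , sum≤2+β) = +-cancelˡ-≤ 2 _ _ (≤-trans (outside-∈ v L v∈L) sum≤2+β)
    ... | inj₂ sum≤β           = ≤-trans (outside≤degreeSum v L) sum≤β

    dominates : ∀ v → k ≤ countIn v D
    dominates v = +-cancelʳ-≤ β k (countIn v D) (begin
      k + β                        ≡⟨ |D|≡k+β ⟨
      length D                     ≡⟨ countIn+outside v D ⟨
      countIn v D + outside v D    ≤⟨ +-monoʳ-≤ (countIn v D) (≤-trans (outside-take v (k + β) L) (outside≤β v)) ⟩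
      countIn v D + β              ∎)
      where open ≤-Reasoning

nearRegular⊕clique : ℕ → ℕ → List Edge
nearRegular⊕clique α m = nearRegular (parity α) 0 m ++ nearRegular (parity (suc α)) m (suc (suc α))

module _ {α m : ℕ} (α<m : α < m) where

  private
    p = suc (suc α)
    sparse = nearRegular (parity α) 0 m
    clique = nearRegular (parity (suc α)) m p
    sparse-within = within-nearRegular (parity α) 0 α<m
    clique-within = within-nearRegular (parity (suc α)) m (n<1+n (suc α))

  isEdge-nearRegular⊕clique : All (IsEdge (m + p)) (nearRegular⊕clique α m)
  isEdge-nearRegular⊕clique = All.++⁺
    (All.map (λ {e} → within⇒isEdge e (m≤m+n m p)) sparse-within)
    (All.map (λ {e} → within⇒isEdge e ≤-refl) clique-within)

  unique-nearRegular⊕clique : Unique (nearRegular⊕clique α m)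
  unique-nearRegular⊕clique = Unique.++⁺
    (unique-nearRegular (parity α) 0 α<m)
    (unique-nearRegular (parity (suc α)) m (n<1+n (suc α)))
    (separated⇒disjoint proj₁ {m}
      (All.map (λ { {i , j} (_ , i<j , j<m) → <-trans i<j j<m }) sparse-within)
      (All.map (λ { {i , j} (m≤i , _) → m≤i }) clique-within))

  degree-nearRegular⊕clique : ∀ a →
    degree a (nearRegular⊕clique α m) ≤ α * count a (interval 0 m) + suc α * count a (interval m p)
  degree-nearRegular⊕clique a = begin
    degree a (sparse ++ clique)            ≡⟨ degree-++ a sparse clique ⟩
    degree a sparse + degree a clique      ≤⟨ +-mono-≤ (degree-nearRegular a (parity α) 0 α<m)
                                                       (degree-nearRegular a (parity (suc α)) m (n<1+n (suc α))) ⟩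
    α * count a (interval 0 m) + suc α * count a (interval m p) ∎
    where open ≤-Reasoning

  degree-nearRegular⊕clique-≤ : ∀ a → degree a (nearRegular⊕clique α m) ≤ suc α
  degree-nearRegular⊕clique-≤ a = begin
    degree a (nearRegular⊕clique α m)  ≤⟨ degree-nearRegular⊕clique a ⟩
    α * x + suc α * y                  ≤⟨ +-monoˡ-≤ (suc α * y) (*-monoˡ-≤ x (n≤1+n α)) ⟩
    suc α * x + suc α * y              ≡⟨ *-distribˡ-+ (suc α) x y ⟨
    suc α * (x + y)                    ≤⟨ *-monoʳ-≤ (suc α) x+y≤1 ⟩
    suc α * 1                          ≡⟨ *-identityʳ (suc α) ⟩
    suc α                              ∎
    where
    open ≤-Reasoning
    x = count a (interval 0 m)
    y = count a (interval m p)
    x+y≤1 : x + y ≤ 1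
    x+y≤1 = subst (_≤ 1) (sym (count-interval-++ a 0 m p)) (count-interval-≤1 a 0 (m + p))

  degree-nearRegular⊕clique-< : ∀ {a} → a < m → degree a (nearRegular⊕clique α m) ≤ α
  degree-nearRegular⊕clique-< {a} a<m = begin
    degree a (nearRegular⊕clique α m)                      ≤⟨ degree-nearRegular⊕clique a ⟩
    α * count a (interval 0 m) + suc α * count a (interval m p) ≡⟨ cong (λ y → α * count a (interval 0 m) + suc α * y) (count-interval-< p a<m) ⟩
    α * count a (interval 0 m) + suc α * 0                 ≡⟨ cong (α * count a (interval 0 m) +_) (*-zeroʳ (suc α)) ⟩
    α * count a (interval 0 m) + 0                         ≡⟨ +-identityʳ _ ⟩
    α * count a (interval 0 m)                             ≤⟨ *-monoʳ-≤ α (count-interval-≤1 a 0 m) ⟩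
    α * 1                                                  ≡⟨ *-identityʳ α ⟩
    α                                                      ∎
    where open ≤-Reasoning

  degreeSumBound-nearRegular⊕clique : DegreeSumBound (m + p) (2 * α + 1) (nearRegular⊕clique α m)
  degreeSumBound-nearRegular⊕clique {a} {b} (a<b , b<m+p) with a <? m
  ... | yes a<m = inj₂ (begin
    degree a G + degree b G  ≤⟨ +-mono-≤ (degree-nearRegular⊕clique-< a<m) (degree-nearRegular⊕clique-≤ b) ⟩
    α + suc α                ≡⟨ α+[1+α] α ⟩
    2 * α + 1                ∎)
    where
    open ≤-Reasoning
    G = nearRegular⊕clique α m
    α+[1+α] : ∀ α → α + suc α ≡ 2 * α + 1
    α+[1+α] = solve-∀
  ... | no a≮m = inj₁ (∈-++⁺ʳ sparse (complete-nearRegular (parity (suc α)) m (≮⇒≥ a≮m) a<b b<m+p) , (begin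
    degree a G + degree b G  ≤⟨ +-mono-≤ (degree-nearRegular⊕clique-≤ a) (degree-nearRegular⊕clique-≤ b) ⟩
    suc α + suc α            ≡⟨ [1+α]+[1+α] α ⟩
    1 + (2 * α + 1)          ≤⟨ n≤1+n _ ⟩
    2 + (2 * α + 1)          ∎))
    where
    open ≤-Reasoning
    G = nearRegular⊕clique α m
    [1+α]+[1+α] : ∀ α → suc α + suc α ≡ 1 + (2 * α + 1)
    [1+α]+[1+α] = solve-∀

  length-nearRegular⊕clique : α * m + suc α * p ≤ suc (2 * length (nearRegular⊕clique α m))
  length-nearRegular⊕clique = begin
    α * m + suc α * p                                  ≤⟨ +-mono-≤ (length-nearRegular (parity α) 0 α<m)
                                                                   (≤-reflexive (sym (length-nearRegular-suc (parity (suc α)) m))) ⟩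
    suc (2 * length sparse) + 2 * length clique        ≡⟨ cong suc (*-distribˡ-+ 2 (length sparse) (length clique)) ⟨
    suc (2 * (length sparse + length clique))          ≡⟨ cong (suc ∘ (2 *_)) (length-++ sparse) ⟨
    suc (2 * length (sparse ++ clique))                ∎
    where open ≤-Reasoning

2*m≤1+2*n⇒m≤n : ∀ {m n} → 2 * m ≤ suc (2 * n) → m ≤ n
2*m≤1+2*n⇒m≤n {m} {n} 2m≤1+2n =
  s≤s⁻¹ (*-cancelˡ-< 2 m (suc n) (≤-<-trans 2m≤1+2n (subst (suc (2 * n) <_) (sym (*-suc 2 n)) (n<1+n _))))

kTupleDominating-nearRegular⊕clique : ∀ α k m → α < m → 2 * k + α ≤ α * (m + α) →
  KTupleDominatingSet (m + suc (suc α)) k (k + 2 * α + 1)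
kTupleDominating-nearRegular⊕clique α k m α<m 2k+α≤α[m+α] =
  map₂ (map₂ (λ |D|≡ → trans |D|≡ (sym (+-assoc k (2 * α) 1))))
    (kTupleDominating-fromEdges k (2 * α + 1)
      (isEdge-nearRegular⊕clique α<m) (unique-nearRegular⊕clique α<m) (degreeSumBound-nearRegular⊕clique α<m)
      enough-edges)
  where
  enough-edges : k + (2 * α + 1) ≤ length (nearRegular⊕clique α m)
  enough-edges = 2*m≤1+2*n⇒m≤n (begin
    2 * (k + (2 * α + 1))          ≡⟨ split k α ⟩
    (2 * k + α) + (3 * α + 2)      ≤⟨ +-monoˡ-≤ (3 * α + 2) 2k+α≤α[m+α] ⟩
    α * (m + α) + (3 * α + 2)      ≡⟨ regroup α m ⟩
    α * m + suc α * suc (suc α)    ≤⟨ length-nearRegular⊕clique α<m ⟩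
    suc (2 * length (nearRegular⊕clique α m)) ∎)
    where
    open ≤-Reasoning
    split : ∀ k α → 2 * (k + (2 * α + 1)) ≡ (2 * k + α) + (3 * α + 2)
    split = solve-∀
    regroup : ∀ α m → α * (m + α) + (3 * α + 2) ≡ α * m + suc α * suc (suc α)
    regroup = solve-∀

m≤[1+d]*ceilDiv[m,1+d] : ∀ m d → m ≤ suc d * ceilDiv m (suc d)
m≤[1+d]*ceilDiv[m,1+d] m d = +-cancelʳ-≤ d m (suc d * q) (begin
  m + d                  ≡⟨ m≡m%n+[m/n]*n (m + d) (suc d) ⟩
  (m + d) % suc d + q * suc d ≤⟨ +-monoˡ-≤ (q * suc d) (s≤s⁻¹ (m%n<n (m + d) (suc d))) ⟩
  d + q * suc d          ≡⟨ +-comm d (q * suc d) ⟩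
  q * suc d + d          ≡⟨ cong (_+ d) (*-comm q (suc d)) ⟩
  suc d * q + d          ∎)
  where
  open ≤-Reasoning
  q = (m + d) / suc d

kTupleDominating-ceil : ∀ α k c → 2 * α ≤ c → 2 * k ≤ α * c → KTupleDominatingSet (c + 3) k (k + 2 * α + 1)
kTupleDominating-ceil α k c 2α≤c 2k≤αc =
  subst (λ n → KTupleDominatingSet n k (k + 2 * α + 1)) m+2+α≡c+3
    (kTupleDominating-nearRegular⊕clique α k m (s≤s α≤c∸α) 2k+α≤α[m+α])
  where
  α+α≤c = subst (_≤ c) (cong (α +_) (+-identityʳ α)) 2α≤c
  α≤c∸α = m+n≤o⇒m≤o∸n α α+α≤c
  m = suc (c ∸ α)
  m+α≡1+c : m + α ≡ suc c
  m+α≡1+c = cong suc (m∸n+n≡m (≤-trans (m≤m+n α α) α+α≤c))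
  2k+α≤α[m+α] : 2 * k + α ≤ α * (m + α)
  2k+α≤α[m+α] = begin
    2 * k + α     ≤⟨ +-monoˡ-≤ α 2k≤αc ⟩
    α * c + α     ≡⟨ +-comm (α * c) α ⟩
    α + α * c     ≡⟨ *-suc α c ⟨
    α * suc c     ≡⟨ cong (α *_) m+α≡1+c ⟨
    α * (m + α)   ∎
    where open ≤-Reasoning
  m+2+α≡c+3 : m + suc (suc α) ≡ c + 3
  m+2+α≡c+3 = begin
    m + suc (suc α)       ≡⟨ +-suc m (suc α) ⟩
    suc (m + suc α)       ≡⟨ cong suc (+-suc m α) ⟩
    suc (suc (m + α))     ≡⟨ cong (suc ∘ suc) m+α≡1+c ⟩
    3 + c                 ≡⟨ +-comm 3 c ⟩
    c + 3                 ∎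
    where open ≡-Reasoning

lemma26 : (α k n : ℕ) → 2 ≤ α → 2 * α + 3 ≤ n → n ≡ ceilDiv (2 * k) α + 3 →
    Σ (List (Vertex n)) (λ D → IsKTupleDominating n k D × length D ≡ k + 2 * α + 1)
lemma26 (suc d) k _ _ 2α+3≤n refl =
  kTupleDominating-ceil (suc d) k c (+-cancelʳ-≤ 3 (2 * suc d) c 2α+3≤n) (m≤[1+d]*ceilDiv[m,1+d] (2 * k) d)
  where c = ceilDiv (2 * k) (suc d)
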